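{- Let $F$ be a CNF formula. If $F$ has a Hitting refutation of size $m$ (i.e., consisting of $m$ clauses), then $F$ has a tree-like resolution refutation of size at most $O(2^{2\log^3 m})$.
   Context: A clause is a disjunction of literals, viewed as a set of literals; a CNF is a conjunction (set) of clauses. A hitting formula is a CNF $H=C_1\wedge\dots\wedge C_m$ such that every two distinct clauses $C_i,C_j$ contain complementary literals (some literal $\ell\in C_i$ with $\bar\ell\in C_j$). A Hitting refutation of a CNF $F$ is an unsatisfiable hitting formula $H$ such that every clause $C$ of $H$ has a clause $C'\subseteq C$ belonging to $F$; its size is the number of clauses of $H$. Tree-like resolution refutations are resolution refutations (resolution rule: from $C\vee x$ and $D\vee\bar x$ derive $C\vee D$) in which every derived clause is used at most once as a premise; size is the number of clauses in the refutation. Logarithms are base 2. -}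

module Defs where

open import Data.Nat using (ℕ; suc; _+_; _*_; _^_; _<_; _≤_)
open import Data.Bool using (Bool; not)
open import Data.Product using (Σ; _×_; ∃; ∃-syntax)
open import Data.Sum using (_⊎_)
open import Data.List using (List; []; length)
open import Data.List.Membership.Propositional using (_∈_)
open import Data.List.Relation.Binary.Subset.Propositional using (_⊆_)
open import Data.List.Relation.Unary.All using (All)
open import Data.List.Relation.Unary.Any using (Any)
open import Data.List.Relation.Unary.AllPairs using (AllPairs)
open import Relation.Binary.PropositionalEquality using (_≡_; _≢_)
open import Relation.Nullary using (¬_)
open import Function.Bundles using (_⇔_)

-- Variables are natural numbers; a literal is a variable with a polarity
-- (pol = true: positive literal x, pol = false: negative literal x̄).
record Lit : Set where
  constructor lit
  field
    var : ℕ
    pol : Bool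
open Lit public

neg : Lit → Lit
neg (lit v p) = lit v (not p)

-- A clause is a (finite) set of literals, represented by a list
-- (only membership matters); a CNF is a list of clauses.
Clause : Set
Clause = List Lit

CNF : Set
CNF = List Clause

Assignment : Set
Assignment = ℕ → Bool

LitTrue : Assignment → Lit → Set
LitTrue α l = α (var l) ≡ pol l

ClauseSat : Assignment → Clause → Set
ClauseSat α C = Any (LitTrue α) C

Satisfiable : CNF → Set
Satisfiable F = ∃[ α ] All (ClauseSat α) F

Unsatisfiable : CNF → Set
Unsatisfiable F = ¬ Satisfiable F

Clash : Clause → Clause → Set
Clash C D = ∃[ l ] (l ∈ C × neg l ∈ D)

-- hitting formula: every two distinct clauses (distinct list positions) clash
IsHitting : CNF → Set
IsHitting H = AllPairs Clash H

IsHittingRefutation : CNF → CNF → Set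
IsHittingRefutation F H =
  IsHitting H × Unsatisfiable H × All (λ C → Any (λ C' → C' ⊆ C) F) H

-- Each node is an
-- occurrence of a clause; every derived clause is used exactly once as a
-- premise (tree shape).  Resolution: from P₁ ∋ x and P₂ ∋ x̄ derive
-- E = (P₁ ∖ {x}) ∪ (P₂ ∖ {x̄}) (as sets, i.e. up to membership).
data TreeDeriv (F : CNF) : Clause → Set where
  axiom : ∀ {C} → C ∈ F → TreeDeriv F C
  resolve : ∀ {P₁ P₂ E} (x : Lit) →
            TreeDeriv F P₁ → TreeDeriv F P₂ →
            x ∈ P₁ → neg x ∈ P₂ →
            (∀ l → (l ∈ E) ⇔ ((l ∈ P₁ × l ≢ x) ⊎ (l ∈ P₂ × l ≢ neg x))) →
            TreeDeriv F E

size : ∀ {F C} → TreeDeriv F C → ℕ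
size (axiom _) = 1
size (resolve _ d₁ d₂ _ _ _) = suc (size d₁ + size d₂)

TreeRefutation : CNF → Set
TreeRefutation F = TreeDeriv F []

-- BoundedBy c m s  expresses the real inequality
--     s ≤ c · 2^(2 · (log₂ m)^3)       (for s, c, m ≥ 1)
-- using only natural numbers: it says that every nonnegative rational
-- p/q < log₂ s − log₂ c  (i.e. 2^p·c^q < s^q) is below 2·(u/v)^3 for every
-- rational u/v > log₂ m (i.e. m^v < 2^u).
BoundedBy : ℕ → ℕ → ℕ → Set
BoundedBy c m s =
  ∀ p q u v → 0 < q → 0 < v →
  2 ^ p * c ^ q < s ^ q → m ^ v < 2 ^ u →
  p * v ^ 3 < 2 * u ^ 3 * q

module Submission where

-- Kraft's inequality for an unsatisfiable hitting formula H: if a restriction leaves the variables U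
-- free, the surviving clauses, each weighted by the 2^(|U| − width) assignments to U falsifying it,
-- cover all 2^|U| assignments.  Hence of c surviving clauses one, C, has width at most log₂ c ≤ ℓ
-- (ℓ = ⌊log₂ |H|⌋), and as every other survivor clashes with C on a free variable, some variable of C
-- is clashed on by at least (c − 1)/ℓ survivors.  Setting it to satisfy C leaves at most c − 1
-- survivors, setting it the other way at most c − (c − 1)/ℓ; refuting both restrictions recursively
-- and resolving on the variable gives a tree-like refutation of size at most 2 c^(ℓ² + ℓ), which is
-- 2^O(log³ |H|).

open import Defs
open import Data.Nat using (ℕ; zero; suc; _+_; _*_; _^_; _∸_; _≤_; _<_; z≤n; s≤s; s≤s⁻¹; _≡ᵇ_; >-nonZero)
open import Data.Nat.Properties
open import Data.Nat.Tactic.RingSolver using (solve-∀)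
open import Data.Bool using (Bool; true; false; not; _∧_; _∨_; if_then_else_) renaming (_≟_ to _≟ᵇ_)
open import Data.Bool.Properties using (∧-assoc; T-≡)
open import Data.Bool.ListAction using (all; any)
open import Data.Product using (Σ; _×_; ∃; ∃-syntax; _,_; proj₁; proj₂)
open import Data.Sum using (_⊎_; inj₁; inj₂)
open import Data.Unit using (⊤; tt)
open import Data.Empty using (⊥; ⊥-elim)
open import Data.List using (List; []; _∷_; length; _++_; map; filter)
open import Data.List.Extrema.Nat using (argmax; argmax-sel; f[⊥]≤f[argmax]; f[xs]≤f[argmax])
open import Data.List.Membership.Propositional using (_∈_; find; lose)
open import Data.List.Membership.Propositional.Properties
  using (∈-map⁺; ∈-∃++; ∈-++⁺ˡ; ∈-++⁺ʳ; ∈-++⁻; ∈-filter⁺; ∈-filter⁻)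
open import Data.List.Relation.Binary.Subset.Propositional using (_⊆_)
open import Data.List.Relation.Unary.All using (All; []; _∷_; lookup)
open import Data.List.Relation.Unary.All.Properties using (all⁺)
open import Data.List.Relation.Unary.AllPairs using (AllPairs; _∷_)
open import Data.List.Relation.Unary.Any using (Any; here; there)
open import Data.List.Relation.Unary.Any.Properties using (any⁺; any⁻)
open import Function using (_∘_)
open import Function.Bundles using (Equivalence; mk⇔)
open import Relation.Nullary using (¬_; Dec; yes; no; ¬?)
open import Relation.Binary.PropositionalEquality

private variable A B : Set

∑ : List A → (A → ℕ) → ℕ
∑ [] f = 0
∑ (x ∷ xs) f = f x + ∑ xs f

syntax ∑ xs (λ x → e) = ∑[ x ∈ xs ] e

∑-cong : ∀ (xs : List A) {f g} → (∀ x → f x ≡ g x) → ∑ xs f ≡ ∑ xs g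
∑-cong [] eq = refl
∑-cong (x ∷ xs) eq = cong₂ _+_ (eq x) (∑-cong xs eq)

∑-mono-≤ : ∀ (xs : List A) {f g} → (∀ {x} → x ∈ xs → f x ≤ g x) → ∑ xs f ≤ ∑ xs g
∑-mono-≤ [] le = z≤n
∑-mono-≤ (x ∷ xs) le = +-mono-≤ (le (here refl)) (∑-mono-≤ xs (le ∘ there))

∑-++ : ∀ (xs ys : List A) f → ∑ (xs ++ ys) f ≡ ∑ xs f + ∑ ys f
∑-++ [] ys f = refl
∑-++ (x ∷ xs) ys f rewrite ∑-++ xs ys f = sym (+-assoc (f x) _ _)

∑-distrib-+ : ∀ (xs : List A) f g → ∑[ x ∈ xs ] (f x + g x) ≡ ∑ xs f + ∑ xs g
∑-distrib-+ [] f g = refl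
∑-distrib-+ (x ∷ xs) f g rewrite ∑-distrib-+ xs f g = +-+-comm (f x) (g x) (∑ xs f) (∑ xs g)
  where
  +-+-comm : ∀ a b c d → a + b + (c + d) ≡ a + c + (b + d)
  +-+-comm = solve-∀

∑-distribˡ-* : ∀ (xs : List A) k f → ∑[ x ∈ xs ] (k * f x) ≡ k * ∑ xs f
∑-distribˡ-* [] k f = sym (*-zeroʳ k)
∑-distribˡ-* (x ∷ xs) k f rewrite ∑-distribˡ-* xs k f = sym (*-distribˡ-+ k (f x) (∑ xs f))

∈⇒≤∑ : ∀ {xs : List A} {x} f → x ∈ xs → f x ≤ ∑ xs f
∈⇒≤∑ f (here refl) = m≤m+n _ _
∈⇒≤∑ {xs = y ∷ _} f (there x∈) = ≤-trans (∈⇒≤∑ f x∈) (m≤n+m _ (f y))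

∑-zero : ∀ (xs : List A) → ∑[ _ ∈ xs ] 0 ≡ 0
∑-zero [] = refl
∑-zero (_ ∷ xs) = ∑-zero xs

∑-comm : ∀ (xs : List A) (ys : List B) (g : A → B → ℕ) →
         ∑[ x ∈ xs ] ∑ ys (g x) ≡ ∑[ y ∈ ys ] ∑[ x ∈ xs ] g x y
∑-comm [] ys g = sym (∑-zero ys)
∑-comm (x ∷ xs) ys g rewrite ∑-comm xs ys g = sym (∑-distrib-+ ys (g x) _)

𝟙 : Bool → ℕ
𝟙 true = 1
𝟙 false = 0

∑𝟙≤length : ∀ (xs : List A) (p : A → Bool) → ∑[ x ∈ xs ] 𝟙 (p x) ≤ length xs
∑𝟙≤length [] p = z≤n
∑𝟙≤length (x ∷ xs) p = +-mono-≤ (𝟙≤1 (p x)) (∑𝟙≤length xs p)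
  where
  𝟙≤1 : ∀ b → 𝟙 b ≤ 1
  𝟙≤1 true = ≤-refl
  𝟙≤1 false = z≤n

infix 7 _==_ _∈ᵇ_

_==_ : Bool → Bool → Bool
true == b = b
false == b = not b

false≢true : false ≢ true
false≢true ()

==-refl : ∀ b → b == b ≡ true
==-refl true = refl
==-refl false = refl

==⇒≡ : ∀ {a b} → a == b ≡ true → a ≡ b
==⇒≡ {true} {true} _ = refl
==⇒≡ {false} {false} _ = refl

==-false⇒≡not : ∀ {a b} → a == b ≡ false → b ≡ not a
==-false⇒≡not {true} {false} _ = refl
==-false⇒≡not {false} {true} _ = refl

≡ᵇ-refl : ∀ n → (n ≡ᵇ n) ≡ true
≡ᵇ-refl zero = refl
≡ᵇ-refl (suc n) = ≡ᵇ-refl n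

≡ᵇ-true⇒≡ : ∀ {m n} → (m ≡ᵇ n) ≡ true → m ≡ n
≡ᵇ-true⇒≡ {m} {n} eq = ≡ᵇ⇒≡ m n (Equivalence.from T-≡ eq)

≡ᵇ-sym : ∀ m n → (m ≡ᵇ n) ≡ (n ≡ᵇ m)
≡ᵇ-sym zero zero = refl
≡ᵇ-sym zero (suc n) = refl
≡ᵇ-sym (suc m) zero = refl
≡ᵇ-sym (suc m) (suc n) = ≡ᵇ-sym m n

module _ {p : A → Bool} where

  all-true⇒∈ : ∀ {xs x} → all p xs ≡ true → x ∈ xs → p x ≡ true
  all-true⇒∈ {xs} h x∈ = Equivalence.to T-≡ (lookup (all⁺ p xs (Equivalence.from T-≡ h)) x∈)

  ∈⇒any-true : ∀ {xs x} → x ∈ xs → p x ≡ true → any p xs ≡ true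
  ∈⇒any-true x∈ px = Equivalence.to T-≡ (any⁺ p (lose x∈ (Equivalence.from T-≡ px)))

  any-true⇒∃ : ∀ {xs} → any p xs ≡ true → ∃[ x ] (x ∈ xs × p x ≡ true)
  any-true⇒∃ {xs} h with find (any⁻ p xs (Equivalence.from T-≡ h))
  ... | x , x∈ , px = x , x∈ , Equivalence.to T-≡ px

_∈ᵇ_ : ℕ → List ℕ → Bool
v ∈ᵇ U = any (v ≡ᵇ_) U

∈ᵇ⇒∈ : ∀ {v U} → v ∈ᵇ U ≡ true → v ∈ U
∈ᵇ⇒∈ {v} h with any-true⇒∃ {p = v ≡ᵇ_} h
... | w , w∈ , v≡w = subst (_∈ _) (sym (≡ᵇ-true⇒≡ v≡w)) w∈

∈⇒∈ᵇ : ∀ {v U} → v ∈ U → v ∈ᵇ U ≡ true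
∈⇒∈ᵇ {v} v∈ = ∈⇒any-true {p = v ≡ᵇ_} v∈ (≡ᵇ-refl v)

Distinct : List ℕ → Set
Distinct [] = ⊤
Distinct (x ∷ U) = (x ∈ᵇ U ≡ false) × Distinct U

remove : ℕ → List ℕ → List ℕ
remove v [] = []
remove v (z ∷ U) = if z ≡ᵇ v then remove v U else z ∷ remove v U

∈ᵇ-remove : ∀ y v U → (y ≡ᵇ v) ≡ false → y ∈ᵇ remove v U ≡ y ∈ᵇ U
∈ᵇ-remove y v [] _ = refl
∈ᵇ-remove y v (z ∷ U) y≢v with z ≡ᵇ v in z≡v
... | true = trans (∈ᵇ-remove y v U y≢v) (cong (_∨ y ∈ᵇ U) (sym y≢z))
  where
  y≢z : (y ≡ᵇ z) ≡ false
  y≢z = subst (λ w → (y ≡ᵇ w) ≡ false) (sym (≡ᵇ-true⇒≡ z≡v)) y≢v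
... | false = cong ((y ≡ᵇ z) ∨_) (∈ᵇ-remove y v U y≢v)

∉ᵇ-remove : ∀ v U → v ∈ᵇ remove v U ≡ false
∉ᵇ-remove v [] = refl
∉ᵇ-remove v (z ∷ U) with z ≡ᵇ v in z≡v
... | true = ∉ᵇ-remove v U
... | false = trans (cong (_∨ v ∈ᵇ remove v U) (trans (≡ᵇ-sym v z) z≡v)) (∉ᵇ-remove v U)

∉ᵇ⇒∉ᵇ-remove : ∀ y v U → y ∈ᵇ U ≡ false → y ∈ᵇ remove v U ≡ false
∉ᵇ⇒∉ᵇ-remove y v [] _ = refl
∉ᵇ⇒∉ᵇ-remove y v (z ∷ U) y∉ with y ≡ᵇ z in y≡z
∉ᵇ⇒∉ᵇ-remove y v (z ∷ U) () | true
... | false with z ≡ᵇ v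
...   | true = ∉ᵇ⇒∉ᵇ-remove y v U y∉
...   | false = trans (cong (_∨ y ∈ᵇ remove v U) y≡z) (∉ᵇ⇒∉ᵇ-remove y v U y∉)

Distinct-remove : ∀ v U → Distinct U → Distinct (remove v U)
Distinct-remove v [] _ = tt
Distinct-remove v (z ∷ U) (z∉U , dU) with z ≡ᵇ v
... | true = Distinct-remove v U dU
... | false = ∉ᵇ⇒∉ᵇ-remove z v U z∉U , Distinct-remove v U dU

∈ᵇ-remove-split : ∀ v U → v ∈ᵇ U ≡ true → ∀ y → y ∈ᵇ U ≡ (y ≡ᵇ v) ∨ y ∈ᵇ remove v U
∈ᵇ-remove-split v U v∈U y with y ≡ᵇ v in y≡v
... | true = subst (λ w → w ∈ᵇ U ≡ true) (sym (≡ᵇ-true⇒≡ {y} {v} y≡v)) v∈U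
... | false = sym (∈ᵇ-remove y v U y≡v)

evalLit : Assignment → Lit → Bool
evalLit α l = α (var l) == pol l

-- A restriction is a list U of free variables together with an assignment α,
-- which fixes every variable outside U.
survives : List ℕ → Assignment → Clause → Bool
survives U α C = all (λ l → var l ∈ᵇ U ∨ not (evalLit α l)) C

occurs : Clause → ℕ → Bool → Bool
occurs C v b = any (λ l → (var l ≡ᵇ v) ∧ (pol l == b)) C

mentions : Clause → ℕ → Bool
mentions C v = occurs C v true ∨ occurs C v false

width : List ℕ → Clause → ℕ
width U C = ∑[ v ∈ U ] 𝟙 (mentions C v)

nonTautologicalOn : List ℕ → Clause → Bool
nonTautologicalOn U C = all (λ v → not (occurs C v true ∧ occurs C v false)) U

-- The number of assignments to U that falsify C under the restriction.
weight : List ℕ → Assignment → Clause → ℕ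
weight U α C = if survives U α C ∧ nonTautologicalOn U C then 2 ^ (length U ∸ width U C) else 0

_[_≔_] : Assignment → ℕ → Bool → Assignment
(α [ x ≔ b ]) y = if y ≡ᵇ x then b else α y

survives-[≔] : ∀ {U U′} x α b C → (∀ y → y ∈ᵇ U ≡ (y ≡ᵇ x) ∨ y ∈ᵇ U′) → x ∈ᵇ U′ ≡ false →
               survives U′ (α [ x ≔ b ]) C ≡ survives U α C ∧ not (occurs C x b)
survives-[≔] x α b [] U-split x∉U′ = refl
survives-[≔] {U} {U′} x α b (l ∷ C) U-split x∉U′ =
  trans (cong (_ ∧_) (survives-[≔] {U} {U′} x α b C U-split x∉U′))
        (literal-step (survives U α C) (occurs C x b))
  where
  literal-step : ∀ s o →
    (var l ∈ᵇ U′ ∨ not (evalLit (α [ x ≔ b ]) l)) ∧ (s ∧ not o)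
      ≡ ((var l ∈ᵇ U ∨ not (evalLit α l)) ∧ s) ∧ not (((var l ≡ᵇ x) ∧ (pol l == b)) ∨ o)
  literal-step s o rewrite U-split (var l) with var l ≡ᵇ x in l≡x
  ... | true rewrite subst (λ z → z ∈ᵇ U′ ≡ false) (sym (≡ᵇ-true⇒≡ {var l} {x} l≡x)) x∉U′ =
    on-x s o (pol l) b
    where
    on-x : ∀ s o p b → not (b == p) ∧ (s ∧ not o) ≡ s ∧ not ((p == b) ∨ o)
    on-x true o true true = refl
    on-x true o true false = refl
    on-x true o false true = refl
    on-x true o false false = refl
    on-x false o true true = refl
    on-x false o true false = refl
    on-x false o false true = refl
    on-x false o false false = refl
  ... | false = sym (∧-assoc (var l ∈ᵇ U′ ∨ not (evalLit α l)) s (not o))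

-- A clause survives both halves only if it does not mention x, and then freeing x doubles its weight.
weight-split : ∀ x U α C → x ∈ᵇ U ≡ false →
               weight U (α [ x ≔ false ]) C + weight U (α [ x ≔ true ]) C ≤ weight (x ∷ U) α C
weight-split x U α C x∉U
  rewrite survives-[≔] {x ∷ U} {U} x α false C (λ _ → refl) x∉U
        | survives-[≔] {x ∷ U} {U} x α true C (λ _ → refl) x∉U
  = halves (survives (x ∷ U) α C) (nonTautologicalOn U C) (occurs C x true) (occurs C x false)
           (length U) (width U C) (∑𝟙≤length U (mentions C))
  where
  halves : ∀ s n o₁ o₀ (u w : ℕ) → w ≤ u →
    (if (s ∧ not o₀) ∧ n then 2 ^ (u ∸ w) else 0) + (if (s ∧ not o₁) ∧ n then 2 ^ (u ∸ w) else 0)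
      ≤ (if s ∧ (not (o₁ ∧ o₀) ∧ n) then 2 ^ (suc u ∸ (𝟙 (o₁ ∨ o₀) + w)) else 0)
  halves false n o₁ o₀ u w _ = z≤n
  halves true false true true u w _ = z≤n
  halves true false true false u w _ = z≤n
  halves true false false true u w _ = z≤n
  halves true false false false u w _ = z≤n
  halves true true true true u w _ = z≤n
  halves true true true false u w _ = ≤-reflexive (+-identityʳ _)
  halves true true false true u w _ = ≤-refl
  halves true true false false u w w≤u
    rewrite +-∸-assoc 1 w≤u = ≤-reflexive (cong (2 ^ (u ∸ w) +_) (sym (*-identityˡ _)))

some-clause-falsified : ∀ β (G : CNF) → ¬ All (ClauseSat β) G → ∃[ C ] (C ∈ G × survives [] β C ≡ true)
some-clause-falsified β [] ¬sat = ⊥-elim (¬sat [])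
some-clause-falsified β (C ∷ G) ¬sat with satisfied-or-falsified C
  where
  satisfied-or-falsified : ∀ C → ClauseSat β C ⊎ survives [] β C ≡ true
  satisfied-or-falsified [] = inj₂ refl
  satisfied-or-falsified (l ∷ C) with evalLit β l in l-true
  ... | true = inj₁ (here (==⇒≡ l-true))
  ... | false with satisfied-or-falsified C
  ...   | inj₁ sat = inj₁ (there sat)
  ...   | inj₂ fal = inj₂ fal
... | inj₂ fal = C , here refl , fal
... | inj₁ sat with some-clause-falsified β G (¬sat ∘ (sat ∷_))
...   | D , D∈ , fal = D , there D∈ , fal

-- Every assignment to U is counted by the weight of some clause it falsifies.
kraft : ∀ H → Unsatisfiable H → ∀ U → Distinct U → ∀ α → 2 ^ length U ≤ ∑ H (weight U α)
kraft H unsat [] _ α with some-clause-falsified α H (λ sat → unsat (α , sat))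
... | C , C∈H , fal = ≤-trans (≤-reflexive (sym w≡1)) (∈⇒≤∑ (weight [] α) C∈H)
  where
  w≡1 : weight [] α C ≡ 1
  w≡1 rewrite fal = refl
kraft H unsat (x ∷ U) (x∉U , dU) α = begin
    2 ^ length U + (2 ^ length U + 0)
  ≡⟨ cong (2 ^ length U +_) (+-identityʳ _) ⟩
    2 ^ length U + 2 ^ length U
  ≤⟨ +-mono-≤ (kraft H unsat U dU (α [ x ≔ false ])) (kraft H unsat U dU (α [ x ≔ true ])) ⟩
    ∑ H (weight U (α [ x ≔ false ])) + ∑ H (weight U (α [ x ≔ true ]))
  ≡⟨ ∑-distrib-+ H _ _ ⟨
    ∑[ C ∈ H ] (weight U (α [ x ≔ false ]) C + weight U (α [ x ≔ true ]) C)
  ≤⟨ ∑-mono-≤ H (λ {C} _ → weight-split x U α C x∉U) ⟩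
    ∑ H (weight (x ∷ U) α)
  ∎
  where open ≤-Reasoning

survivors : CNF → List ℕ → Assignment → ℕ
survivors H U α = ∑[ D ∈ H ] 𝟙 (survives U α D)

weight-positive : ∀ U α C → 0 < weight U α C → survives U α C ≡ true × nonTautologicalOn U C ≡ true
weight-positive U α C with survives U α C | nonTautologicalOn U C
... | true | true = λ _ → refl , refl
... | true | false = λ ()
... | false | _ = λ ()

2^width*weight≡2^length : ∀ U α C → survives U α C ≡ true → nonTautologicalOn U C ≡ true →
                          2 ^ width U C * weight U α C ≡ 2 ^ length U
2^width*weight≡2^length U α C s n rewrite s | n =
  trans (sym (^-distribˡ-+-* 2 (width U C) _)) (cong (2 ^_) (m+[n∸m]≡n (∑𝟙≤length U (mentions C))))

weight≤*𝟙survives : ∀ U α D M → weight U α D ≤ M → weight U α D ≤ M * 𝟙 (survives U α D)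
weight≤*𝟙survives U α D M with survives U α D
... | true = λ w≤M → ≤-trans w≤M (≤-reflexive (sym (*-identityʳ M)))
... | false = λ _ → z≤n

maximiser : ∀ (f : A → ℕ) {xs} → 0 < ∑ xs f → ∃[ y ] (y ∈ xs × (∀ {z} → z ∈ xs → f z ≤ f y))
maximiser f {x ∷ xs} _ = argmax f x xs , argmax-∈ , argmax-≥
  where
  argmax-∈ : argmax f x xs ∈ x ∷ xs
  argmax-∈ with argmax-sel f x xs
  ... | inj₁ ≡x = here ≡x
  ... | inj₂ ∈xs = there ∈xs
  argmax-≥ : ∀ {z} → z ∈ x ∷ xs → f z ≤ f (argmax f x xs)
  argmax-≥ (here refl) = f[⊥]≤f[argmax] {f = f} x xs
  argmax-≥ (there z∈) = lookup (f[xs]≤f[argmax] {f = f} x xs) z∈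

record ShortSurvivor (H : CNF) (U : List ℕ) (α : Assignment) : Set where
  field
    clause : Clause
    clause∈H : clause ∈ H
    clause-survives : survives U α clause ≡ true
    clause-nonTautological : nonTautologicalOn U clause ≡ true
    short : 2 ^ width U clause ≤ survivors H U α

-- A survivor of maximal weight has weight at least 2^|U| / survivors, by Kraft.
shortSurvivor : ∀ H → Unsatisfiable H → ∀ U → Distinct U → ∀ α → ShortSurvivor H U α
shortSurvivor H unsat U dU α = record
  { clause = C ; clause∈H = C∈H ; clause-survives = s ; clause-nonTautological = n
  ; short = *-cancelʳ-≤ (2 ^ width U C) (survivors H U α) (weight U α C) {{>-nonZero w>0}} short′ }
  where
  kraft-U = kraft H unsat U dU α
  max = maximiser (weight U α) (≤-trans (m^n>0 2 (length U)) kraft-U)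
  C = proj₁ max
  C∈H = proj₁ (proj₂ max)
  kraft-C : 2 ^ length U ≤ weight U α C * survivors H U α
  kraft-C = begin
      2 ^ length U
    ≤⟨ kraft-U ⟩
      ∑ H (weight U α)
    ≤⟨ ∑-mono-≤ H (λ {D} D∈H → weight≤*𝟙survives U α D _ (proj₂ (proj₂ max) D∈H)) ⟩
      ∑[ D ∈ H ] (weight U α C * 𝟙 (survives U α D))
    ≡⟨ ∑-distribˡ-* H (weight U α C) _ ⟩
      weight U α C * survivors H U α
    ∎
    where open ≤-Reasoning
  w>0 : 0 < weight U α C
  w>0 = *-cancelʳ-< _ 0 (weight U α C) (<-≤-trans (m^n>0 2 (length U)) kraft-C)
  s = proj₁ (weight-positive U α C w>0)
  n = proj₂ (weight-positive U α C w>0)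
  short′ : 2 ^ width U C * weight U α C ≤ survivors H U α * weight U α C
  short′ = subst₂ _≤_ (sym (2^width*weight≡2^length U α C s n))
                      (*-comm (weight U α C) (survivors H U α)) kraft-C

∈⇒occurs : ∀ {v p C} → lit v p ∈ C → occurs C v p ≡ true
∈⇒occurs {v} {p} l∈C = ∈⇒any-true l∈C (trans (cong (_∧ (p == p)) (≡ᵇ-refl v)) (==-refl p))

occurs⇒mentions : ∀ C v p → occurs C v p ≡ true → mentions C v ≡ true
occurs⇒mentions C v true occ rewrite occ = refl
occurs⇒mentions C v false occ with occurs C v true
... | true = refl
... | false = occ

-- The sign of v in C, meaningful when C mentions v but not with both signs.
polarity : Clause → ℕ → Bool
polarity C v = occurs C v true

mentions⇒occurs-polarity : ∀ C v → mentions C v ≡ true → occurs C v (polarity C v) ≡ true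
mentions⇒occurs-polarity C v with occurs C v true in pos
... | true = λ _ → pos
... | false = λ occ → occ

clashing : CNF → List ℕ → Assignment → Clause → ℕ → ℕ
clashing H U α C v = ∑[ D ∈ H ] 𝟙 (survives U α D ∧ occurs D v (not (polarity C v)))

clash-on-free-variable : ∀ {U α C D v p} → survives U α C ≡ true → survives U α D ≡ true →
                         lit v p ∈ C → lit v (not p) ∈ D → v ∈ᵇ U ≡ true
clash-on-free-variable {U} {α} {v = v} {p} sC sD l∈C l̄∈D with v ∈ᵇ U in v∈?
... | true = refl
... | false = ⊥-elim (α-falsifies-both (α v) p
                       (subst (λ z → z ∨ not (α v == p) ≡ true) v∈? (all-true⇒∈ sC l∈C))
                       (subst (λ z → z ∨ not (α v == not p) ≡ true) v∈? (all-true⇒∈ sD l̄∈D)))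
  where
  α-falsifies-both : ∀ a p → not (a == p) ≡ true → not (a == not p) ≡ true → ⊥
  α-falsifies-both true true () _
  α-falsifies-both true false _ ()
  α-falsifies-both false true _ ()
  α-falsifies-both false false () _

occurs-opposite : ∀ {C D v p} → not (occurs C v true ∧ occurs C v false) ≡ true →
                  lit v p ∈ C → lit v (not p) ∈ D → occurs D v (not (polarity C v)) ≡ true
occurs-opposite {C} {D} {v} {true} _ l∈C l̄∈D rewrite ∈⇒occurs l∈C = ∈⇒occurs l̄∈D
occurs-opposite {C} {D} {v} {false} nt l∈C l̄∈D rewrite ∈⇒occurs l∈C with occurs C v true
... | false = ∈⇒occurs l̄∈D
occurs-opposite {C} {D} {v} {false} () l∈C l̄∈D | true

survivor-clashes : ∀ {U α C D} → survives U α C ≡ true → nonTautologicalOn U C ≡ true → Clash C D →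
                   𝟙 (survives U α D)
                     ≤ ∑[ v ∈ U ] (𝟙 (mentions C v) * 𝟙 (survives U α D ∧ occurs D v (not (polarity C v))))
survivor-clashes {U} {α} {C} {D} sC ntC (lit v p , l∈C , l̄∈D) with survives U α D in sD
... | false = z≤n
... | true = ≤-trans (1≤𝟙*𝟙 (occurs⇒mentions C v p (∈⇒occurs l∈C))
                            (occurs-opposite (all-true⇒∈ ntC v∈U) l∈C l̄∈D))
                     (∈⇒≤∑ (λ w → 𝟙 (mentions C w) * 𝟙 (true ∧ occurs D w (not (polarity C w)))) v∈U)
  where
  v∈U : v ∈ U
  v∈U = ∈ᵇ⇒∈ (clash-on-free-variable {U} {α} sC sD l∈C l̄∈D)
  1≤𝟙*𝟙 : ∀ {a b} → a ≡ true → b ≡ true → 1 ≤ 𝟙 a * 𝟙 b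
  1≤𝟙*𝟙 refl refl = ≤-refl

AllPairs-middle : ∀ {R : A → A → Set} xs {y} zs → AllPairs R (xs ++ y ∷ zs) →
                  (∀ {x} → x ∈ xs → R x y) × (∀ {z} → z ∈ zs → R y z)
AllPairs-middle [] zs (y-zs ∷ _) = (λ ()) , lookup y-zs
AllPairs-middle (x ∷ xs) zs (x-rest ∷ rest) with AllPairs-middle xs zs rest
... | xs-y , y-zs = (λ { (here refl) → lookup x-rest (∈-++⁺ʳ xs (here refl))
                       ; (there x∈) → xs-y x∈ })
                  , y-zs

Clash-sym : ∀ {C D} → Clash D C → Clash C D
Clash-sym {C} {D} (l , l∈D , l̄∈C) = neg l , l̄∈C , subst (_∈ D) (sym (neg-involutive l)) l∈D
  where
  neg-involutive : ∀ l → neg (neg l) ≡ l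
  neg-involutive (lit v true) = refl
  neg-involutive (lit v false) = refl

-- In a hitting formula every other survivor clashes with C on a free variable of C.
survivors∸1≤∑clashing : ∀ {H} U α {C} → IsHitting H → C ∈ H → survives U α C ≡ true →
                        nonTautologicalOn U C ≡ true →
                        survivors H U α ∸ 1 ≤ ∑[ v ∈ U ] (𝟙 (mentions C v) * clashing H U α C v)
survivors∸1≤∑clashing U α {C} hitting C∈H sC ntC with ∈-∃++ C∈H
... | pre , post , refl with AllPairs-middle pre post hitting
...   | pre-C , C-post = begin
    survivors H U α ∸ 1
  ≡⟨ cong (_∸ 1) (∑-++ pre (C ∷ post) s) ⟩
    ∑ pre s + (𝟙 (survives U α C) + ∑ post s) ∸ 1
  ≡⟨ cong (λ b → ∑ pre s + (𝟙 b + ∑ post s) ∸ 1) sC ⟩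
    ∑ pre s + suc (∑ post s) ∸ 1
  ≡⟨ cong (_∸ 1) (+-suc (∑ pre s) (∑ post s)) ⟩
    ∑ pre s + ∑ post s
  ≤⟨ +-mono-≤ (∑-mono-≤ pre (λ D∈ → survivor-clashes {U} {α} sC ntC (Clash-sym (pre-C D∈))))
              (∑-mono-≤ post (λ D∈ → survivor-clashes {U} {α} sC ntC (C-post D∈))) ⟩
    ∑ pre g + ∑ post g
  ≤⟨ +-monoʳ-≤ (∑ pre g) (m≤n+m (∑ post g) (g C)) ⟩
    ∑ pre g + (g C + ∑ post g)
  ≡⟨ ∑-++ pre (C ∷ post) g ⟨
    ∑ H g
  ≡⟨ ∑-comm H U (λ D v → 𝟙 (mentions C v) * o D v) ⟩
    ∑[ v ∈ U ] ∑[ D ∈ H ] (𝟙 (mentions C v) * o D v)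
  ≡⟨ ∑-cong U (λ v → ∑-distribˡ-* H (𝟙 (mentions C v)) (λ D → o D v)) ⟩
    ∑[ v ∈ U ] (𝟙 (mentions C v) * clashing H U α C v)
  ∎
  where
  open ≤-Reasoning
  H = pre ++ C ∷ post
  s : Clause → ℕ
  s D = 𝟙 (survives U α D)
  o : Clause → ℕ → ℕ
  o D v = 𝟙 (survives U α D ∧ occurs D v (not (polarity C v)))
  g : Clause → ℕ
  g D = ∑[ v ∈ U ] (𝟙 (mentions C v) * o D v)

record BranchingVariable (H : CNF) (U : List ℕ) (α : Assignment) (C : Clause) : Set where
  field
    v : ℕ
    v∈U : v ∈ U
    C-mentions-v : mentions C v ≡ true
    many-clash : survivors H U α ∸ 1 ≤ width U C * clashing H U α C v

branchingVariable : ∀ {H} U α {C} → IsHitting H → C ∈ H → survives U α C ≡ true →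
                    nonTautologicalOn U C ≡ true → 2 ≤ survivors H U α → BranchingVariable H U α C
branchingVariable {H} U α {C} hitting C∈H sC ntC 2≤c =
  record { v = v ; v∈U = v∈U ; C-mentions-v = proj₁ mentioned ; many-clash = proj₂ mentioned }
  where
  f : ℕ → ℕ
  f z = 𝟙 (mentions C z) * clashing H U α C z
  c∸1≤∑f = survivors∸1≤∑clashing U α hitting C∈H sC ntC
  max = maximiser f (≤-trans (∸-monoˡ-≤ 1 2≤c) c∸1≤∑f)
  v = proj₁ max
  v∈U = proj₁ (proj₂ max)
  ≤f[v]*𝟙 : ∀ z → f z ≤ f v → f z ≤ f v * 𝟙 (mentions C z)
  ≤f[v]*𝟙 z with mentions C z
  ... | true = λ le → ≤-trans le (≤-reflexive (sym (*-identityʳ (f v))))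
  ... | false = λ _ → z≤n
  c∸1≤f[v]*width : survivors H U α ∸ 1 ≤ f v * width U C
  c∸1≤f[v]*width = begin
      survivors H U α ∸ 1
    ≤⟨ c∸1≤∑f ⟩
      ∑ U f
    ≤⟨ ∑-mono-≤ U (λ {z} z∈U → ≤f[v]*𝟙 z (proj₂ (proj₂ max) z∈U)) ⟩
      ∑[ z ∈ U ] (f v * 𝟙 (mentions C z))
    ≡⟨ ∑-distribˡ-* U (f v) _ ⟩
      f v * width U C
    ∎
    where open ≤-Reasoning
  𝟙-factor-true : ∀ b r w c → 1 ≤ c → c ≤ 𝟙 b * r * w → b ≡ true × c ≤ w * r
  𝟙-factor-true true r w c _ le = refl , subst (c ≤_) (trans (cong (_* w) (+-identityʳ r)) (*-comm r w)) le
  𝟙-factor-true false r w c 1≤c le = ⊥-elim (<-irrefl refl (≤-trans 1≤c le))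
  mentioned = 𝟙-factor-true (mentions C v) (clashing H U α C v) (width U C) _
                         (∸-monoˡ-≤ 1 2≤c) c∸1≤f[v]*width

survivors-split : ∀ H U α v b → v ∈ᵇ U ≡ true →
                  survivors H U α
                    ≡ survivors H (remove v U) (α [ v ≔ b ]) + ∑[ D ∈ H ] 𝟙 (survives U α D ∧ occurs D v b)
survivors-split H U α v b v∈U = begin
    survivors H U α
  ≡⟨ ∑-cong H (λ D → 𝟙-split (survives U α D) (occurs D v b)) ⟩
    ∑[ D ∈ H ] (𝟙 (survives U α D ∧ not (occurs D v b)) + 𝟙 (survives U α D ∧ occurs D v b))
  ≡⟨ ∑-distrib-+ H _ _ ⟩
    ∑[ D ∈ H ] 𝟙 (survives U α D ∧ not (occurs D v b)) + killed
  ≡⟨ cong (_+ killed) (∑-cong H (λ D → cong 𝟙 (survives-[≔] {U} {remove v U} v α b D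
                                                  (∈ᵇ-remove-split v U v∈U) (∉ᵇ-remove v U)))) ⟨
    survivors H (remove v U) (α [ v ≔ b ]) + killed
  ∎
  where
  open ≡-Reasoning
  killed = ∑[ D ∈ H ] 𝟙 (survives U α D ∧ occurs D v b)
  𝟙-split : ∀ a o → 𝟙 a ≡ 𝟙 (a ∧ not o) + 𝟙 (a ∧ o)
  𝟙-split true true = refl
  𝟙-split true false = refl
  𝟙-split false o = refl

_≟ˡ_ : (l l′ : Lit) → Dec (l ≡ l′)
lit v p ≟ˡ lit w q with v ≟ w | p ≟ᵇ q
... | yes refl | yes refl = yes refl
... | no v≢w | _ = no (v≢w ∘ cong var)
... | yes _ | no p≢q = no (p≢q ∘ cong pol)

module Refutations (F H : CNF) where

  open import Data.List.Membership.DecPropositional _≟ˡ_ using (_∈?_)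

  FalsifiedLit : List ℕ → Assignment → Lit → Set
  FalsifiedLit U α l = var l ∈ᵇ U ≡ false × evalLit α l ≡ false × Any (l ∈_) H

  Falsified : List ℕ → Assignment → Clause → Set
  Falsified U α E = ∀ {l} → l ∈ E → FalsifiedLit U α l

  -- Deriving a clause falsified by the restriction refutes the restricted formula.  Literals are
  -- required to occur in H so that, once every variable of H is free, the clause must be empty.
  record Refutation (U : List ℕ) (α : Assignment) (B : ℕ) : Set where
    field
      clause : Clause
      derivation : TreeDeriv F clause
      falsified : Falsified U α clause
      size<B : size derivation < B

  open Refutation

  weaken : ∀ {U α B B′} → B ≤ B′ → Refutation U α B → Refutation U α B′
  weaken B≤B′ r = record { clause = clause r ; derivation = derivation r ; falsified = falsified r
                          ; size<B = <-≤-trans (size<B r) B≤B′ }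

  FalsifiedLit-unset : ∀ {U α v b l} → FalsifiedLit (remove v U) (α [ v ≔ b ]) l → l ≢ lit v (not b) →
                       FalsifiedLit U α l
  FalsifiedLit-unset {U} {α} {v} {b} {l} (l∉U , l-false , l∈H) l≢ with var l ≡ᵇ v in l≡v
  ... | true = ⊥-elim (l≢ (cong₂ lit (≡ᵇ-true⇒≡ {var l} {v} l≡v) (==-false⇒≡not l-false)))
  ... | false = trans (sym (∈ᵇ-remove (var l) v U l≡v)) l∉U , l-false , l∈H

  resolveOn : ∀ U α v {E₀ E₁} (d₀ : TreeDeriv F E₀) (d₁ : TreeDeriv F E₁) →
              Falsified (remove v U) (α [ v ≔ false ]) E₀ → Falsified (remove v U) (α [ v ≔ true ]) E₁ →
              Refutation U α (suc (size d₀) + suc (size d₁))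
  resolveOn U α v {E₀} {E₁} d₀ d₁ f₀ f₁ with lit v true ∈? E₀ | lit v false ∈? E₁
  ... | no v∉E₀ | _ = record
    { clause = E₀ ; derivation = d₀ ; size<B = m≤m+n _ _
    ; falsified = λ l∈ → FalsifiedLit-unset {U} {α} (f₀ l∈) (v∉E₀ ∘ λ { refl → l∈ }) }
  ... | yes _ | no v̄∉E₁ = record
    { clause = E₁ ; derivation = d₁ ; size<B = m≤n+m _ (suc (size d₀))
    ; falsified = λ l∈ → FalsifiedLit-unset {U} {α} (f₁ l∈) (v̄∉E₁ ∘ λ { refl → l∈ }) }
  ... | yes v∈E₀ | yes v̄∈E₁ = record
    { clause = E ; derivation = resolve (lit v true) d₀ d₁ v∈E₀ v̄∈E₁ (λ _ → mk⇔ split join)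
    ; falsified = falsified-E ; size<B = ≤-reflexive (cong suc (sym (+-suc (size d₀) (size d₁)))) }
    where
    keep₀ = λ l → ¬? (l ≟ˡ lit v true)
    keep₁ = λ l → ¬? (l ≟ˡ lit v false)
    E = filter keep₀ E₀ ++ filter keep₁ E₁
    split : ∀ {l} → l ∈ E → (l ∈ E₀ × l ≢ lit v true) ⊎ (l ∈ E₁ × l ≢ lit v false)
    split l∈ with ∈-++⁻ (filter keep₀ E₀) l∈
    ... | inj₁ l∈₀ = inj₁ (∈-filter⁻ keep₀ l∈₀)
    ... | inj₂ l∈₁ = inj₂ (∈-filter⁻ keep₁ l∈₁)
    join : ∀ {l} → (l ∈ E₀ × l ≢ lit v true) ⊎ (l ∈ E₁ × l ≢ lit v false) → l ∈ E
    join (inj₁ (l∈₀ , l≢)) = ∈-++⁺ˡ (∈-filter⁺ keep₀ l∈₀ l≢)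
    join (inj₂ (l∈₁ , l≢)) = ∈-++⁺ʳ (filter keep₀ E₀) (∈-filter⁺ keep₁ l∈₁ l≢)
    falsified-E : Falsified U α E
    falsified-E l∈ with split l∈
    ... | inj₁ (l∈₀ , l≢) = FalsifiedLit-unset {U} {α} (f₀ l∈₀) l≢
    ... | inj₂ (l∈₁ , l≢) = FalsifiedLit-unset {U} {α} (f₁ l∈₁) l≢

  resolveRefutations : ∀ {U α B₀ B₁} v b → Refutation (remove v U) (α [ v ≔ b ]) B₀ →
                       Refutation (remove v U) (α [ v ≔ not b ]) B₁ → Refutation U α (B₀ + B₁)
  resolveRefutations {U} {α} v false r₀ r₁ =
    weaken (+-mono-≤ (size<B r₀) (size<B r₁))
           (resolveOn U α v (derivation r₀) (derivation r₁) (falsified r₀) (falsified r₁))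
  resolveRefutations {U} {α} {B₁ = B₀} v true r₁ r₀ =
    weaken (≤-trans (+-mono-≤ (size<B r₀) (size<B r₁)) (≤-reflexive (+-comm B₀ _)))
           (resolveOn U α v (derivation r₀) (derivation r₁) (falsified r₀) (falsified r₁))

  axiomRefutation : All (λ C → Any (_⊆ C) F) H → ∀ {U α C} → C ∈ H → survives U α C ≡ true →
                    width U C ≡ 0 → Refutation U α 2
  axiomRefutation subsumed {U} {α} {C} C∈H sC w≡0 with find (lookup subsumed C∈H)
  ... | C′ , C′∈F , C′⊆C = record { clause = C′ ; derivation = axiom C′∈F ; size<B = ≤-refl
                                  ; falsified = λ l∈ → falsifiedLit (C′⊆C l∈) }
    where
    falsifiedLit : ∀ {l} → l ∈ C → FalsifiedLit U α l
    falsifiedLit {l} l∈C = l∉U , l-false , lose C∈H l∈C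
      where
      l∉U : var l ∈ᵇ U ≡ false
      l∉U with var l ∈ᵇ U in l∈?
      ... | false = refl
      ... | true = ⊥-elim (1+n≰n (begin
            1                           ≡⟨ cong 𝟙 (occurs⇒mentions C (var l) (pol l) (∈⇒occurs l∈C)) ⟨
            𝟙 (mentions C (var l))      ≤⟨ ∈⇒≤∑ {xs = U} (λ v → 𝟙 (mentions C v)) (∈ᵇ⇒∈ {U = U} l∈?) ⟩
            width U C                   ≡⟨ w≡0 ⟩
            0                           ∎))
        where open ≤-Reasoning
      l-false : evalLit α l ≡ false
      l-false with evalLit α l | all-true⇒∈ sC l∈C
      ... | false | _ = refl
      ... | true | l-unfixed = ⊥-elim (false≢true (trans (cong (_∨ false) (sym l∉U)) l-unfixed))

pow-branch-≤ : ∀ {a b c} K → 1 ≤ c → a ≤ c ∸ 1 → b ≤ c ∸ 1 → 2 * a ^ suc K + 2 * b ^ K ≤ 2 * c ^ suc K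
pow-branch-≤ {a} {b} {suc d} K _ a≤d b≤d = begin
    2 * (a * a ^ K) + 2 * b ^ K
  ≤⟨ +-mono-≤ (*-monoʳ-≤ 2 (*-mono-≤ a≤d (^-monoˡ-≤ K a≤d))) (*-monoʳ-≤ 2 (^-monoˡ-≤ K b≤d)) ⟩
    2 * (d * d ^ K) + 2 * d ^ K
  ≡⟨ *-distribˡ-+ 2 (d * d ^ K) (d ^ K) ⟨
    2 * (d * d ^ K + d ^ K)
  ≡⟨ cong (2 *_) (+-comm (d * d ^ K) (d ^ K)) ⟩
    2 * (suc d * d ^ K)
  ≤⟨ *-monoʳ-≤ 2 (*-monoʳ-≤ (suc d) (^-monoˡ-≤ K (n≤1+n d))) ⟩
    2 * (suc d * suc d ^ K)
  ∎
  where open ≤-Reasoning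

-- The potential behind the exponent ℓ j + t of the size bound.  While c − 1 ≥ 2^j, a big branching
-- (removing at least (c − 1)/ℓ survivors) lowers ℓ (c − 1) by at least 2^j and spends one unit of t;
-- when t is used up, c − 1 < 2^j and j + 1 is traded for j with t = ℓ.
Affordable : ℕ → ℕ → ℕ → ℕ → Set
Affordable ℓ c j t = ℓ * (c ∸ 1) < (ℓ + t) * 2 ^ j

affordable-initial : ∀ {ℓ c} → 1 ≤ ℓ → c < 2 ^ suc ℓ → Affordable ℓ c ℓ ℓ
affordable-initial {ℓ} {c} 1≤ℓ c<2^1+ℓ = subst (ℓ * (c ∸ 1) <_) (ℓ*2x≡[ℓ+ℓ]*x ℓ (2 ^ ℓ))
  (*-monoʳ-< ℓ {{>-nonZero 1≤ℓ}} (≤-<-trans (m∸n≤m c 1) c<2^1+ℓ))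
  where
  ℓ*2x≡[ℓ+ℓ]*x : ∀ ℓ x → ℓ * (2 * x) ≡ (ℓ + ℓ) * x
  ℓ*2x≡[ℓ+ℓ]*x = solve-∀

affordable-halve : ∀ {ℓ c} j → Affordable ℓ c (suc j) 0 → Affordable ℓ c j ℓ
affordable-halve {ℓ} {c} j = subst (ℓ * (c ∸ 1) <_) ([ℓ+0]*2x≡[ℓ+ℓ]*x ℓ (2 ^ j))
  where
  [ℓ+0]*2x≡[ℓ+ℓ]*x : ∀ ℓ x → (ℓ + 0) * (2 * x) ≡ (ℓ + ℓ) * x
  [ℓ+0]*2x≡[ℓ+ℓ]*x = solve-∀

affordable-0-0 : ∀ {ℓ c} → Affordable ℓ c 0 0 → c ≤ 1
affordable-0-0 {ℓ} {c} aff = m∸n≡0⇒m≤n (n<1⇒n≡0 (*-cancelˡ-< ℓ (c ∸ 1) 1 (subst (ℓ * (c ∸ 1) <_) ℓ≡ aff)))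
  where
  ℓ≡ : (ℓ + 0) * 1 ≡ ℓ * 1
  ℓ≡ = cong (_* 1) (+-identityʳ ℓ)

affordable-mono : ∀ {ℓ c c′} j t → c′ ≤ c → Affordable ℓ c j t → Affordable ℓ c′ j t
affordable-mono {ℓ} j t c′≤c = ≤-<-trans (*-monoʳ-≤ ℓ (∸-monoˡ-≤ 1 c′≤c))

affordable-big : ∀ {ℓ c c′ r} j t → 1 ≤ ℓ → c ≡ c′ + r → c ∸ 1 ≤ ℓ * r →
                 Affordable ℓ c j (suc t) → Affordable ℓ c′ j t
affordable-big {ℓ} {c} {zero} j t 1≤ℓ _ _ _ =
  subst (_< (ℓ + t) * 2 ^ j) (sym (*-zeroʳ ℓ)) (*-mono-≤ (≤-trans 1≤ℓ (m≤m+n ℓ t)) (m^n>0 2 j))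
affordable-big {ℓ} {.(suc (c′ + r))} {suc c′} {r} j t 1≤ℓ refl c∸1≤ℓr aff with 2 ^ j ≤? c′ + r
... | yes 2^j≤c∸1 = +-cancelʳ-< (2 ^ j) (ℓ * c′) ((ℓ + t) * 2 ^ j) (begin-strict
    ℓ * c′ + 2 ^ j
  ≤⟨ +-monoʳ-≤ (ℓ * c′) (≤-trans 2^j≤c∸1 c∸1≤ℓr) ⟩
    ℓ * c′ + ℓ * r
  ≡⟨ *-distribˡ-+ ℓ c′ r ⟨
    ℓ * (c′ + r)
  <⟨ aff ⟩
    (ℓ + suc t) * 2 ^ j
  ≡⟨ cong (_* 2 ^ j) (+-suc ℓ t) ⟩
    2 ^ j + (ℓ + t) * 2 ^ j
  ≡⟨ +-comm (2 ^ j) _ ⟩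
    (ℓ + t) * 2 ^ j + 2 ^ j
  ∎)
  where open ≤-Reasoning
... | no 2^j≰c∸1 = begin-strict
    ℓ * c′
  ≤⟨ *-monoʳ-≤ ℓ (m≤m+n c′ r) ⟩
    ℓ * (c′ + r)
  <⟨ *-monoʳ-< ℓ {{>-nonZero 1≤ℓ}} (≰⇒> 2^j≰c∸1) ⟩
    ℓ * 2 ^ j
  ≤⟨ *-monoˡ-≤ (2 ^ j) (m≤m+n ℓ t) ⟩
    (ℓ + t) * 2 ^ j
  ∎
  where open ≤-Reasoning

2^-cancel-< : ∀ {a b} → 2 ^ a < 2 ^ b → a < b
2^-cancel-< {a} {b} 2^a<2^b with a <? b
... | yes a<b = a<b
... | no a≮b = ⊥-elim (<-irrefl refl (<-≤-trans 2^a<2^b (^-monoʳ-≤ 2 (≮⇒≥ a≮b))))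

module _ {H U α} (S : ShortSurvivor H U α) where
  open ShortSurvivor S

  width≡0⊎2≤survivors : width U clause ≡ 0 ⊎ 2 ≤ survivors H U α
  width≡0⊎2≤survivors with width U clause in w≡
  ... | zero = inj₁ refl
  ... | suc w = inj₂ (≤-trans (*-monoʳ-≤ 2 (m^n>0 2 w)) (subst (λ x → 2 ^ x ≤ _) w≡ short))

  width<log₂ : ∀ {ℓ} → length H < 2 ^ suc ℓ → width U clause ≤ ℓ
  width<log₂ H<2^1+ℓ = s≤s⁻¹ (2^-cancel-< (≤-<-trans (≤-trans short (∑𝟙≤length H (survives U α))) H<2^1+ℓ))

module Construction (F H : CNF) (hitting : IsHitting H) (unsat : Unsatisfiable H)
                    (subsumed : All (λ C → Any (_⊆ C) F) H)
                    (ℓ : ℕ) (1≤ℓ : 1 ≤ ℓ) (H<2^1+ℓ : length H < 2 ^ suc ℓ) where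

  open Refutations F H public

  Bounded : List ℕ → Assignment → ℕ → Set
  Bounded U α K = Refutation U α (2 * survivors H U α ^ K)

  leaf : ∀ {U α} (S : ShortSurvivor H U α) → width U (ShortSurvivor.clause S) ≡ 0 → ∀ K → Bounded U α K
  leaf {U} {α} S w≡0 K =
    weaken (*-monoʳ-≤ 2 (m^n>0 (survivors H U α) {{>-nonZero 1≤c}} K))
           (axiomRefutation subsumed clause∈H clause-survives w≡0)
    where
    open ShortSurvivor S
    1≤c : 1 ≤ survivors H U α
    1≤c = subst (λ w → 2 ^ w ≤ _) w≡0 short

  record Split (U : List ℕ) (α : Assignment) : Set where
    field
      v : ℕ
      b : Bool
      v∈U : v ∈ᵇ U ≡ true
      r : ℕ
      small : survivors H (remove v U) (α [ v ≔ b ]) ≤ survivors H U α ∸ 1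
      big : survivors H U α ≡ survivors H (remove v U) (α [ v ≔ not b ]) + r
      many : survivors H U α ∸ 1 ≤ ℓ * r

  -- Setting v to satisfy the short clause C kills C; setting it the other way kills every survivor
  -- clashing with C on v, which are many by the choice of v.
  split : ∀ {U α} → ShortSurvivor H U α → 2 ≤ survivors H U α → Split U α
  split {U} {α} S 2≤c = record
    { v = v ; b = b ; v∈U = v∈ᵇU ; r = clashing H U α C v
    ; small = m+n≤o⇒m≤o∸n cs (subst (cs + 1 ≤_) (sym c≡) (+-monoʳ-≤ cs C-killed))
    ; big = survivors-split H U α v (not b) v∈ᵇU
    ; many = ≤-trans many-clash (*-monoˡ-≤ (clashing H U α C v) (width<log₂ S {ℓ} H<2^1+ℓ)) }
    where
    open ShortSurvivor S renaming (clause to C)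
    open BranchingVariable (branchingVariable U α hitting clause∈H clause-survives clause-nonTautological 2≤c)
    b = polarity C v
    v∈ᵇU = ∈⇒∈ᵇ v∈U
    cs = survivors H (remove v U) (α [ v ≔ b ])
    c≡ = survivors-split H U α v b v∈ᵇU
    C-occurs-b : occurs C v b ≡ true
    C-occurs-b = mentions⇒occurs-polarity C v C-mentions-v
    C-killed : 1 ≤ ∑[ D ∈ H ] 𝟙 (survives U α D ∧ occurs D v b)
    C-killed = ≤-trans (≤-reflexive (cong₂ (λ s o → 𝟙 (s ∧ o)) (sym clause-survives) (sym C-occurs-b)))
                       (∈⇒≤∑ (λ D → 𝟙 (survives U α D ∧ occurs D v b)) clause∈H)

  derive : ∀ n j t U → Distinct U → ∀ α → survivors H U α ≤ n →
           Affordable ℓ (survivors H U α) j t → Bounded U α (ℓ * j + t)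
  branch : ∀ n j t U → Distinct U → ∀ α → survivors H U α ≤ n → Affordable ℓ (survivors H U α) j t →
           ShortSurvivor H U α → 2 ≤ survivors H U α → Bounded U α (ℓ * j + t)

  derive n j t U dU α c≤n aff with shortSurvivor H unsat U dU α
  ... | S with width≡0⊎2≤survivors S
  ...   | inj₁ w≡0 = leaf S w≡0 (ℓ * j + t)
  ...   | inj₂ 2≤c = branch n j t U dU α c≤n aff S 2≤c

  branch n zero zero U dU α c≤n aff S 2≤c = ⊥-elim (1+n≰n (≤-trans 2≤c (affordable-0-0 {ℓ} aff)))
  branch n (suc j) zero U dU α c≤n aff S 2≤c =
    subst (Bounded U α) (ℓj+ℓ≡ℓ[1+j]+0 ℓ j)
          (derive n j ℓ U dU α c≤n (affordable-halve {ℓ} {survivors H U α} j aff))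
    where
    ℓj+ℓ≡ℓ[1+j]+0 : ∀ ℓ j → ℓ * j + ℓ ≡ ℓ * suc j + 0
    ℓj+ℓ≡ℓ[1+j]+0 = solve-∀
  branch zero j (suc t) U dU α c≤0 aff S 2≤c = ⊥-elim (1+n≰n (≤-trans 2≤c (≤-trans c≤0 z≤n)))
  branch (suc n) j (suc t) U dU α c≤1+n aff S 2≤c =
    weaken size-bound (resolveRefutations v b small-refutation big-refutation)
    where
    open Split (split S 2≤c)
    c = survivors H U α
    U′ = remove v U
    cb = survivors H U′ (α [ v ≔ not b ])
    c∸1≤n : c ∸ 1 ≤ n
    c∸1≤n = ∸-monoˡ-≤ 1 c≤1+n
    1≤r : 1 ≤ r
    1≤r = n≢0⇒n>0 (λ r≡0 → 1+n≰n (subst (1 ≤_) (trans (cong (ℓ *_) r≡0) (*-zeroʳ ℓ))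
                                              (≤-trans (∸-monoˡ-≤ 1 2≤c) many)))
    cb≤c∸1 : cb ≤ c ∸ 1
    cb≤c∸1 = m+n≤o⇒m≤o∸n cb (subst (cb + 1 ≤_) (sym big) (+-monoʳ-≤ cb 1≤r))
    small-refutation = derive n j (suc t) U′ (Distinct-remove v U dU) (α [ v ≔ b ]) (≤-trans small c∸1≤n)
                              (affordable-mono {ℓ} j (suc t) (≤-trans small (m∸n≤m c 1)) aff)
    big-refutation = derive n j t U′ (Distinct-remove v U dU) (α [ v ≔ not b ]) (≤-trans cb≤c∸1 c∸1≤n)
                            (affordable-big {ℓ} j t 1≤ℓ big many aff)
    size-bound : 2 * survivors H U′ (α [ v ≔ b ]) ^ (ℓ * j + suc t) + 2 * cb ^ (ℓ * j + t)
                 ≤ 2 * c ^ (ℓ * j + suc t)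
    size-bound rewrite +-suc (ℓ * j) t = pow-branch-≤ (ℓ * j + t) (≤-trans (s≤s z≤n) 2≤c) small cb≤c∸1

variables : CNF → List ℕ
variables [] = []
variables (C ∷ G) = map var C ++ variables G

∈⇒var∈variables : ∀ {G C l} → C ∈ G → l ∈ C → var l ∈ variables G
∈⇒var∈variables (here refl) l∈C = ∈-++⁺ˡ (∈-map⁺ var l∈C)
∈⇒var∈variables {D ∷ _} (there C∈G) l∈C = ∈-++⁺ʳ (map var D) (∈⇒var∈variables C∈G l∈C)

dedup : List ℕ → List ℕ
dedup [] = []
dedup (x ∷ xs) = if x ∈ᵇ dedup xs then dedup xs else x ∷ dedup xs

Distinct-dedup : ∀ xs → Distinct (dedup xs)
Distinct-dedup [] = tt
Distinct-dedup (x ∷ xs) with x ∈ᵇ dedup xs in x∈?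
... | true = Distinct-dedup xs
... | false = x∈? , Distinct-dedup xs

∈ᵇ-dedup : ∀ y xs → y ∈ᵇ xs ≡ true → y ∈ᵇ dedup xs ≡ true
∈ᵇ-dedup y (x ∷ xs) with y ≡ᵇ x in y≡x | x ∈ᵇ dedup xs in x∈?
... | true | true = λ _ → subst (λ z → z ∈ᵇ dedup xs ≡ true) (sym (≡ᵇ-true⇒≡ {y} {x} y≡x)) x∈?
... | true | false rewrite y≡x = λ _ → refl
... | false | true = ∈ᵇ-dedup y xs
... | false | false rewrite y≡x = ∈ᵇ-dedup y xs

-- Starting with every variable of H free, only the empty clause can be falsified.
hittingRefutation⇒treeRefutation : ∀ {F H} → IsHittingRefutation F H → ∀ ℓ → 1 ≤ ℓ → length H < 2 ^ suc ℓ →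
                                   Σ (TreeRefutation F) (λ T → size T < 2 * length H ^ (ℓ * ℓ + ℓ))
hittingRefutation⇒treeRefutation {F} {H} (hitting , unsat , subsumed) ℓ 1≤ℓ H<2^1+ℓ =
  proj₁ T , subst (_< 2 * length H ^ (ℓ * ℓ + ℓ)) (sym (proj₂ T))
                  (<-≤-trans (size<B r) (*-monoʳ-≤ 2 (^-monoˡ-≤ (ℓ * ℓ + ℓ) c≤|H|)))
  where
  open Construction F H hitting unsat subsumed ℓ 1≤ℓ H<2^1+ℓ
  open Refutation
  U₀ = dedup (variables H)
  α₀ : Assignment
  α₀ _ = false
  c≤|H| = ∑𝟙≤length H (survives U₀ α₀)
  r = derive (length H) ℓ ℓ U₀ (Distinct-dedup (variables H)) α₀ c≤|H|
             (affordable-initial 1≤ℓ (≤-<-trans c≤|H| H<2^1+ℓ))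
  unfalsifiable : ∀ {l} → ¬ FalsifiedLit U₀ α₀ l
  unfalsifiable {l} (l∉U₀ , _ , l∈H) with find l∈H
  ... | C , C∈H , l∈C =
    false≢true (trans (sym l∉U₀) (∈ᵇ-dedup (var l) (variables H) (∈⇒∈ᵇ (∈⇒var∈variables C∈H l∈C))))
  root : ∀ {E} (d : TreeDeriv F E) → Falsified U₀ α₀ E → Σ (TreeRefutation F) (λ T → size T ≡ size d)
  root {[]} d _ = d , refl
  root {_ ∷ _} d falsified-E = ⊥-elim (unfalsifiable (falsified-E (here refl)))
  T = root (derivation r) (falsified r)

log₂-bracket : ∀ {m} → 1 ≤ m → ∃[ ℓ ] (2 ^ ℓ ≤ m × m < 2 ^ suc ℓ)
log₂-bracket {m} 1≤m = search m (n<2^n m)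
  where
  n<2^n : ∀ n → n < 2 ^ n
  n<2^n zero = s≤s z≤n
  n<2^n (suc n) = +-mono-≤ (m^n>0 2 n) (≤-trans (n<2^n n) (≤-reflexive (sym (+-identityʳ _))))
  search : ∀ k → m < 2 ^ k → ∃[ ℓ ] (2 ^ ℓ ≤ m × m < 2 ^ suc ℓ)
  search zero m<1 = ⊥-elim (<-irrefl refl (≤-<-trans 1≤m m<1))
  search (suc k) m<2^1+k with m <? 2 ^ k
  ... | yes m<2^k = search k m<2^k
  ... | no m≮2^k = k , ≮⇒≥ m≮2^k , m<2^1+k

2*m^[ℓ²+ℓ]≤2^[1+2ℓ³] : ∀ {m ℓ} → 3 ≤ ℓ → m < 2 ^ suc ℓ → 2 * m ^ (ℓ * ℓ + ℓ) ≤ 2 ^ suc (2 * ℓ ^ 3)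
2*m^[ℓ²+ℓ]≤2^[1+2ℓ³] {m} {ℓ} 3≤ℓ m<2^1+ℓ = *-monoʳ-≤ 2 (begin
    m ^ (ℓ * ℓ + ℓ)
  ≤⟨ ^-monoˡ-≤ (ℓ * ℓ + ℓ) (<⇒≤ m<2^1+ℓ) ⟩
    (2 ^ suc ℓ) ^ (ℓ * ℓ + ℓ)
  ≡⟨ ^-*-assoc 2 (suc ℓ) (ℓ * ℓ + ℓ) ⟩
    2 ^ (suc ℓ * (ℓ * ℓ + ℓ))
  ≤⟨ ^-monoʳ-≤ 2 (exponent-≤ ℓ 3≤ℓ) ⟩
    2 ^ (2 * ℓ ^ 3)
  ∎)
  where
  open ≤-Reasoning
  expand : ∀ k → (1 + (3 + k)) * ((3 + k) * (3 + k) + (3 + k)) + (3 + k) * (k * k + 4 * k + 2)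
                 ≡ 2 * ((3 + k) * ((3 + k) * ((3 + k) * 1)))
  expand = solve-∀
  exponent-≤ : ∀ ℓ → 3 ≤ ℓ → suc ℓ * (ℓ * ℓ + ℓ) ≤ 2 * ℓ ^ 3
  exponent-≤ (suc (suc (suc k))) _ = ≤-trans (m≤m+n _ _) (≤-reflexive (expand k))
  exponent-≤ (suc zero) (s≤s ())
  exponent-≤ (suc (suc zero)) (s≤s (s≤s ()))

-- Read p/q and u/v as rationals: p/q < log₂ s − 1 ≤ 2ℓ³ and ℓ ≤ log₂ m < u/v.
BoundedBy-intro : ∀ {ℓ m s} → 2 ^ ℓ ≤ m → s ≤ 2 ^ suc (2 * ℓ ^ 3) → BoundedBy 2 m s
BoundedBy-intro {ℓ} {m} {s} 2^ℓ≤m s≤ p q u v 0<q 0<v 2^p*2^q<s^q m^v<2^u = begin-strict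
    p * v ^ 3
  <⟨ *-monoˡ-< (v ^ 3) {{m^n≢0 v 3 {{>-nonZero 0<v}}}} p<2ℓ³q ⟩
    2 * ℓ ^ 3 * q * v ^ 3
  ≡⟨ regroup ℓ q v ⟩
    2 * (ℓ * v) ^ 3 * q
  ≤⟨ *-monoˡ-≤ q (*-monoʳ-≤ 2 (^-monoˡ-≤ 3 (<⇒≤ ℓv<u))) ⟩
    2 * u ^ 3 * q
  ∎
  where
  open ≤-Reasoning
  regroup : ∀ (ℓ q v : ℕ) → 2 * (ℓ * (ℓ * (ℓ * 1))) * q * (v * (v * (v * 1)))
                          ≡ 2 * ((ℓ * v) * ((ℓ * v) * ((ℓ * v) * 1))) * q
  regroup = solve-∀
  G = 2 * ℓ ^ 3
  2^[p+q]<2^[[1+G]q] : 2 ^ (p + q) < 2 ^ (suc G * q)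
  2^[p+q]<2^[[1+G]q] = begin-strict
      2 ^ (p + q)
    ≡⟨ ^-distribˡ-+-* 2 p q ⟩
      2 ^ p * 2 ^ q
    <⟨ 2^p*2^q<s^q ⟩
      s ^ q
    ≤⟨ ^-monoˡ-≤ q s≤ ⟩
      (2 ^ suc G) ^ q
    ≡⟨ ^-*-assoc 2 (suc G) q ⟩
      2 ^ (suc G * q)
    ∎
  p<2ℓ³q : p < G * q
  p<2ℓ³q = +-cancelʳ-< q p (G * q) (subst (p + q <_) (+-comm q (G * q)) (2^-cancel-< 2^[p+q]<2^[[1+G]q]))
  ℓv<u : ℓ * v < u
  ℓv<u = 2^-cancel-< (≤-<-trans (≤-trans (≤-reflexive (sym (^-*-assoc 2 ℓ v))) (^-monoˡ-≤ v 2^ℓ≤m)) m^v<2^u)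

theorem3p3 : ∃[ c ] (1 ≤ c × ∃[ m₀ ] (∀ (F H : CNF) (m : ℕ) →
    IsHittingRefutation F H → length H ≡ m → m₀ ≤ m →
    Σ (TreeRefutation F) (λ T → BoundedBy c m (size T))))
theorem3p3 = 2 , s≤s z≤n , 8 , bounded-refutation
  where
  bounded-refutation : ∀ F H m → IsHittingRefutation F H → length H ≡ m → 8 ≤ m →
                       Σ (TreeRefutation F) (λ T → BoundedBy 2 m (size T))
  bounded-refutation F H .(length H) hr refl 8≤m =
    let ℓ , 2^ℓ≤m , m<2^1+ℓ = log₂-bracket (≤-trans (s≤s z≤n) 8≤m)
        3≤ℓ = s≤s⁻¹ (2^-cancel-< (≤-<-trans 8≤m m<2^1+ℓ))
        T , size< = hittingRefutation⇒treeRefutation hr ℓ (≤-trans (s≤s z≤n) 3≤ℓ) m<2^1+ℓ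
    in T , BoundedBy-intro {ℓ} 2^ℓ≤m (<⇒≤ (<-≤-trans size< (2*m^[ℓ²+ℓ]≤2^[1+2ℓ³] 3≤ℓ m<2^1+ℓ)))
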